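{- Let $s$ be a fully normalized binary string of length $n\ge 2$. Then $d_{rpbi}^g(s)=\left\lceil \frac{n-2}{4}\right\rceil$.
   Context: A binary string is $s=s[1]\ldots s[n]$ with each $s[i]\in\{0,1\}$. A string is normalized if no two adjacent symbols are equal; normalizing means replacing every maximal run of identical adjacent symbols by a single copy. A fully normalized binary string is a normalized string over $\{0,1\}$ in which both $0$ and $1$ occur. The block-interchange $\beta(w,x,y,z)$, $1\le w\le x<y\le z\le n$, transforms $s$ into $s[1]\ldots s[w-1]\,s[y]\ldots s[z]\,s[x+1]\ldots s[y-1]\,s[w]\ldots s[x]\,s[z+1]\ldots s[n]$. A restricted prefix block-interchange is an operation of the form $\beta(2,2,y,z)$ with $3\le y\le z\le n$ (the first symbol is kept fixed). A string is grouped if its normalized form contains each of its symbols exactly once. $d_{rpbi}^g(s)$ denotes the minimum number of restricted prefix block-interchanges (each followed by normalization) needed to transform $s$ into a grouped string. -}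

module Defs where

open import Data.Bool using (Bool; true; false)
open import Data.Bool.Properties using () renaming (_≟_ to _≟ᵇ_)
open import Data.Nat using (ℕ; zero; suc; _+_; _∸_; _≤_; _<_)
open import Data.List using (List; []; _∷_; _++_; take; drop; length)
open import Data.List.Membership.Propositional using (_∈_)
open import Data.List.Relation.Unary.Unique.Propositional using (Unique)
open import Data.Product using (Σ; _×_; ∃)
open import Relation.Nullary using (¬_; yes; no)
open import Relation.Binary.PropositionalEquality using (_≡_)

-- Binary strings: lists of Booleans (false = 0, true = 1), 1-indexed in the paper.
BinStr : Set
BinStr = List Bool

data Normalized : BinStr → Set where
  nil  : Normalized []
  one  : ∀ a → Normalized (a ∷ [])
  cons : ∀ {a b s} → ¬ (a ≡ b) → Normalized (b ∷ s) → Normalized (a ∷ b ∷ s)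

normFrom : Bool → BinStr → BinStr
normFrom a [] = a ∷ []
normFrom a (b ∷ s) with a ≟ᵇ b
... | yes _ = normFrom b s
... | no  _ = a ∷ normFrom b s

normalize : BinStr → BinStr
normalize [] = []
normalize (a ∷ s) = normFrom a s

FullyNormalized : BinStr → Set
FullyNormalized s = Normalized s × (false ∈ s) × (true ∈ s)

Grouped : BinStr → Set
Grouped s = Unique (normalize s)

-- 1-indexed segment s[i] … s[j] (empty if j < i).
seg : ℕ → ℕ → BinStr → BinStr
seg i j s = take (suc j ∸ i) (drop (i ∸ 1) s)

-- Block-interchange β(w,x,y,z):
-- s[1..w-1] s[y..z] s[x+1..y-1] s[w..x] s[z+1..n]
β : ℕ → ℕ → ℕ → ℕ → BinStr → BinStr
β w x y z s = take (w ∸ 1) s ++ seg y z s ++ seg (suc x) (y ∸ 1) s ++ seg w x s ++ drop z s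

data RPBIStep : BinStr → BinStr → Set where
  step : ∀ {s} y z → 3 ≤ y → y ≤ z → z ≤ length s →
         RPBIStep s (normalize (β 2 2 y z s))

data Reach : ℕ → BinStr → BinStr → Set where
  done : ∀ {s} → Reach zero s s
  more : ∀ {k s t u} → RPBIStep s t → Reach k t u → Reach (suc k) s u

GroupableIn : ℕ → BinStr → Set
GroupableIn k s = ∃ λ t → Reach k s t × Grouped t

IsDistRPBIg : BinStr → ℕ → Set
IsDistRPBIg s d = GroupableIn d s × (∀ m → m < d → ¬ GroupableIn m s)

module Submission where

-- The distance is governed by the number of runs (maximal blocks of equal
-- adjacent symbols) of a string.
--
-- Normalization does not change the number of runs, and a
-- block-interchange cuts a string into five blocks A B C D E and glues
-- them back as A D C B E.  Cutting increases the number of runs by at most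
-- one per cut (four cuts) and gluing never increases it, so one step
-- decreases the number of runs by at most 4.  A grouped string has at most
-- 2 runs, while a normalized string of length n has n runs; hence
-- n ≤ 4m + 2 after m steps, i.e. m ≥ ⌈(n-2)/4⌉.
--
-- A fully normalized string is alternating, a ā a ā …, and
-- the interchange β(2,2,5,5) turns a ā a ā a ā r into a a a ā ā ā r, which
-- normalizes to a ā r: four symbols are removed per step.  Strings of
-- length 3, 4, 5 are grouped in one step, which gives ⌈(n-2)/4⌉ steps.

open import Defs
open import Data.Nat using (ℕ; _≤_; _∸_; _+_; _/_)
open import Data.List using (length)

open import Data.Nat using (zero; suc; _*_; _<_; z≤n; s≤s)
open import Data.Nat.Properties
open import Data.Nat.DivMod using (m/n≡1+[m∸n]/n; m<n*o⇒m/o<n)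
open import Data.Nat.ListAction using (sum)
open import Data.Nat.ListAction.Properties using (sum-↭)
open import Data.Bool using (Bool; true; false; not)
open import Data.Bool.Properties using () renaming (_≟_ to _≟ᵇ_)
open import Data.List using (List; []; _∷_; _++_; take; drop; concat; map)
open import Data.List.Properties using (take++drop≡id; drop-drop; ++-identityʳ)
open import Data.List.Relation.Binary.Permutation.Propositional
  using (_↭_; ↭-prep; ↭-swap; ↭-trans; ↭-refl)
open import Data.List.Relation.Binary.Permutation.Propositional.Properties
  using (map⁺)
open import Data.List.Relation.Unary.AllPairs using ([]; _∷_)
open import Data.List.Relation.Unary.All using ([]; _∷_)
open import Data.List.Relation.Unary.Unique.Propositional using (Unique)
open import Data.Product using (_,_)
open import Data.Empty using (⊥; ⊥-elim)
open import Relation.Nullary using (¬_; yes; no)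
open import Relation.Binary.PropositionalEquality

-- δ a b is 1 if the adjacent symbols a b start a new run, 0 otherwise.
-- It makes the same case split as normFrom, so the two compute together.
δ : Bool → Bool → ℕ
δ a b with a ≟ᵇ b
... | yes _ = 0
... | no _ = 1

δ≤1 : ∀ a b → δ a b ≤ 1
δ≤1 a b with a ≟ᵇ b
... | yes _ = z≤n
... | no _ = s≤s z≤n

δ-distinct : ∀ {a b} → ¬ a ≡ b → δ a b ≡ 1
δ-distinct {a} {b} a≢b with a ≟ᵇ b
... | yes a≡b = ⊥-elim (a≢b a≡b)
... | no _ = refl

changes : Bool → BinStr → ℕ
changes a [] = 0
changes a (b ∷ s) = δ a b + changes b s

runs : BinStr → ℕ
runs [] = 0
runs (a ∷ s) = suc (changes a s)

runs≤length : ∀ s → runs s ≤ length s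
runs≤length [] = z≤n
runs≤length (a ∷ s) = s≤s (changes≤length a s)
  where
  changes≤length : ∀ a s → changes a s ≤ length s
  changes≤length a [] = z≤n
  changes≤length a (b ∷ s) = +-mono-≤ (δ≤1 a b) (changes≤length b s)

runs-normalized : ∀ {s} → Normalized s → runs s ≡ length s
runs-normalized nil = refl
runs-normalized (one a) = refl
runs-normalized (cons {a} {b} {s} a≢b n) =
  cong suc (trans (cong (_+ changes b s) (δ-distinct a≢b)) (runs-normalized n))

changes-normFrom : ∀ c b s → changes c (normFrom b s) ≡ changes c (b ∷ s)
changes-normFrom c b [] = refl
changes-normFrom c b (d ∷ s) with b ≟ᵇ d
... | yes refl = changes-normFrom c d s
... | no b≢d = cong (δ c b +_) (trans (changes-normFrom b d s) (cong (_+ changes d s) (δ-distinct b≢d)))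

runs-normalize : ∀ s → runs (normalize s) ≡ runs s
runs-normalize [] = refl
runs-normalize (a ∷ s) = runs-normFrom a s
  where
  runs-normFrom : ∀ b s → runs (normFrom b s) ≡ runs (b ∷ s)
  runs-normFrom b [] = refl
  runs-normFrom b (d ∷ s) with b ≟ᵇ d
  ... | yes refl = runs-normFrom d s
  ... | no b≢d = cong suc (trans (changes-normFrom b d s) (cong (_+ changes d s) (δ-distinct b≢d)))

runs-++-≤ : ∀ xs ys → runs (xs ++ ys) ≤ runs xs + runs ys
runs-++-≤ [] ys = ≤-refl
runs-++-≤ (a ∷ xs) ys = s≤s (changes-++ a xs)
  where
  changes≤runs : ∀ a ys → changes a ys ≤ runs ys
  changes≤runs a [] = z≤n
  changes≤runs a (b ∷ ys) = +-monoˡ-≤ (changes b ys) (δ≤1 a b)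

  changes-++ : ∀ a xs → changes a (xs ++ ys) ≤ changes a xs + runs ys
  changes-++ a [] = changes≤runs a ys
  changes-++ a (b ∷ xs) = begin
    δ a b + changes b (xs ++ ys)     ≤⟨ +-monoʳ-≤ (δ a b) (changes-++ b xs) ⟩
    δ a b + (changes b xs + runs ys) ≡⟨ +-assoc (δ a b) _ _ ⟨
    δ a b + changes b xs + runs ys   ∎
    where open ≤-Reasoning

runs-++-≥ : ∀ xs ys → runs xs + runs ys ≤ suc (runs (xs ++ ys))
runs-++-≥ [] ys = n≤1+n _
runs-++-≥ (a ∷ xs) ys = s≤s (changes-++ a xs)
  where
  runs≤1+changes : ∀ a ys → runs ys ≤ suc (changes a ys)
  runs≤1+changes a [] = z≤n
  runs≤1+changes a (b ∷ ys) = s≤s (m≤n+m (changes b ys) (δ a b))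

  changes-++ : ∀ a xs → changes a xs + runs ys ≤ suc (changes a (xs ++ ys))
  changes-++ a [] = runs≤1+changes a ys
  changes-++ a (b ∷ xs) = begin
    δ a b + changes b xs + runs ys     ≡⟨ +-assoc (δ a b) _ _ ⟩
    δ a b + (changes b xs + runs ys)   ≤⟨ +-monoʳ-≤ (δ a b) (changes-++ b xs) ⟩
    δ a b + suc (changes b (xs ++ ys)) ≡⟨ +-suc (δ a b) _ ⟩
    suc (δ a b + changes b (xs ++ ys)) ∎
    where open ≤-Reasoning

runs-concat-≤ : ∀ bs → runs (concat bs) ≤ sum (map runs bs)
runs-concat-≤ [] = z≤n
runs-concat-≤ (b ∷ bs) =
  ≤-trans (runs-++-≤ b (concat bs)) (+-monoʳ-≤ (runs b) (runs-concat-≤ bs))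

sum-runs-≤ : ∀ b bs → sum (map runs (b ∷ bs)) ≤ length bs + runs (concat (b ∷ bs))
sum-runs-≤ b [] = ≤-reflexive (trans (+-identityʳ (runs b)) (cong runs (sym (++-identityʳ b))))
sum-runs-≤ b (c ∷ cs) = begin
  runs b + sum (map runs (c ∷ cs))               ≤⟨ +-monoʳ-≤ (runs b) (sum-runs-≤ c cs) ⟩
  runs b + (length cs + runs rest)               ≡⟨ +-comm (runs b) _ ⟩
  length cs + runs rest + runs b                 ≡⟨ +-assoc (length cs) _ _ ⟩
  length cs + (runs rest + runs b)               ≡⟨ cong (length cs +_) (+-comm (runs rest) _) ⟩
  length cs + (runs b + runs rest)               ≤⟨ +-monoʳ-≤ (length cs) (runs-++-≥ b rest) ⟩
  length cs + suc (runs (b ++ rest))             ≡⟨ +-suc (length cs) _ ⟩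
  suc (length cs) + runs (b ++ rest)             ∎
  where
  open ≤-Reasoning
  rest = concat (c ∷ cs)

concat-five : ∀ (a b c d e : BinStr) → concat (a ∷ b ∷ c ∷ d ∷ e ∷ []) ≡ a ++ b ++ c ++ d ++ e
concat-five a b c d e = cong (λ e′ → a ++ b ++ c ++ d ++ e′) (++-identityʳ e)

seg-split : ∀ i j s → i ≤ j → seg (suc i) j s ++ drop j s ≡ drop i s
seg-split i j s i≤j = begin
  take (j ∸ i) (drop i s) ++ drop j s
    ≡⟨ cong (λ k → take (j ∸ i) (drop i s) ++ drop k s) (m+[n∸m]≡n i≤j) ⟨
  take (j ∸ i) (drop i s) ++ drop (i + (j ∸ i)) s
    ≡⟨ cong (take (j ∸ i) (drop i s) ++_) (drop-drop i (j ∸ i) s) ⟨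
  take (j ∸ i) (drop i s) ++ drop (j ∸ i) (drop i s)
    ≡⟨ take++drop≡id (j ∸ i) (drop i s) ⟩
  drop i s ∎
  where open ≡-Reasoning

blocks : ℕ → ℕ → ℕ → ℕ → BinStr → List BinStr
blocks w x y z s = take (w ∸ 1) s ∷ seg w x s ∷ seg (suc x) (y ∸ 1) s ∷ seg y z s ∷ drop z s ∷ []

blocks-concat : ∀ {w x y z} s → 1 ≤ w → w ≤ x → x < y → y ≤ z → concat (blocks w x y z s) ≡ s
blocks-concat {suc w} {x} {suc y} {z} s _ w<x (s≤s x≤y) y<z = begin
  concat (blocks (suc w) x (suc y) z s)                ≡⟨ concat-five A B C D (drop z s) ⟩
  A ++ B ++ C ++ D ++ drop z s                          ≡⟨ cong (λ r → A ++ B ++ C ++ r) (seg-split y z s (<⇒≤ y<z)) ⟩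
  A ++ B ++ C ++ drop y s                               ≡⟨ cong (λ r → A ++ B ++ r) (seg-split x y s x≤y) ⟩
  A ++ B ++ drop x s                                    ≡⟨ cong (A ++_) (seg-split w x s (<⇒≤ w<x)) ⟩
  A ++ drop w s                                         ≡⟨ take++drop≡id w s ⟩
  s ∎
  where
  open ≡-Reasoning
  A = take w s
  B = seg (suc w) x s
  C = seg (suc x) y s
  D = seg (suc y) z s

-- β keeps the outer blocks and exchanges the second and fourth.
interchange : ∀ {A : Set} (a b c d e : A) → a ∷ b ∷ c ∷ d ∷ e ∷ [] ↭ a ∷ d ∷ c ∷ b ∷ e ∷ []
interchange a b c d e =
  ↭-prep a (↭-trans (↭-swap b c ↭-refl) (↭-trans (↭-prep c (↭-swap b d ↭-refl)) (↭-swap c d ↭-refl)))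

-- One block-interchange removes at most four runs: four cuts, then a gluing.
runs-β : ∀ {w x y z} s → 1 ≤ w → w ≤ x → x < y → y ≤ z → runs s ≤ 4 + runs (β w x y z s)
runs-β {w} {x} {y} {z} s 1≤w w≤x x<y y≤z = begin
  runs s                                     ≡⟨ cong runs (blocks-concat s 1≤w w≤x x<y y≤z) ⟨
  runs (concat (A ∷ B ∷ C ∷ D ∷ E ∷ []))     ≤⟨ runs-concat-≤ (A ∷ B ∷ C ∷ D ∷ E ∷ []) ⟩
  sum (map runs (A ∷ B ∷ C ∷ D ∷ E ∷ []))    ≡⟨ sum-↭ (map⁺ runs (interchange A B C D E)) ⟩
  sum (map runs (A ∷ D ∷ C ∷ B ∷ E ∷ []))    ≤⟨ sum-runs-≤ A (D ∷ C ∷ B ∷ E ∷ []) ⟩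
  4 + runs (concat (A ∷ D ∷ C ∷ B ∷ E ∷ [])) ≡⟨ cong (λ r → 4 + runs r) (concat-five A D C B E) ⟩
  4 + runs (β w x y z s)                     ∎
  where
  open ≤-Reasoning
  A = take (w ∸ 1) s
  B = seg w x s
  C = seg (suc x) (y ∸ 1) s
  D = seg y z s
  E = drop z s

step-runs : ∀ {s t} → RPBIStep s t → runs s ≤ 4 + runs t
step-runs {s} (step y z 3≤y y≤z _) = begin
  runs s                              ≤⟨ runs-β s (s≤s z≤n) ≤-refl 3≤y y≤z ⟩
  4 + runs (β 2 2 y z s)              ≡⟨ cong (4 +_) (runs-normalize (β 2 2 y z s)) ⟨
  4 + runs (normalize (β 2 2 y z s))  ∎
  where open ≤-Reasoning

reach-runs : ∀ {k s t} → Reach k s t → runs s ≤ k * 4 + runs t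
reach-runs done = ≤-refl
reach-runs {suc k} {s} {u} (more {t = t} s→t t→u) = begin
  runs s                    ≤⟨ step-runs s→t ⟩
  4 + runs t                ≤⟨ +-monoʳ-≤ 4 (reach-runs t→u) ⟩
  4 + (k * 4 + runs u)      ≡⟨ +-assoc 4 (k * 4) (runs u) ⟨
  suc k * 4 + runs u        ∎
  where open ≤-Reasoning

unique≤2 : ∀ (xs : List Bool) → Unique xs → length xs ≤ 2
unique≤2 [] _ = z≤n
unique≤2 (a ∷ []) _ = s≤s z≤n
unique≤2 (a ∷ b ∷ []) _ = s≤s (s≤s z≤n)
unique≤2 (a ∷ b ∷ c ∷ xs) ((a≢b ∷ a≢c ∷ _) ∷ (b≢c ∷ _) ∷ _) = ⊥-elim (pigeonhole a b c a≢b a≢c b≢c)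
  where
  pigeonhole : ∀ (a b c : Bool) → ¬ a ≡ b → ¬ a ≡ c → ¬ b ≡ c → ⊥
  pigeonhole false false _ a≢b _ _ = a≢b refl
  pigeonhole true true _ a≢b _ _ = a≢b refl
  pigeonhole false true false _ a≢c _ = a≢c refl
  pigeonhole true false true _ a≢c _ = a≢c refl
  pigeonhole false true true _ _ b≢c = b≢c refl
  pigeonhole true false false _ _ b≢c = b≢c refl

grouped-runs : ∀ t → Grouped t → runs t ≤ 2
grouped-runs t g = begin
  runs t                    ≡⟨ runs-normalize t ⟨
  runs (normalize t)        ≤⟨ runs≤length (normalize t) ⟩
  length (normalize t)      ≤⟨ unique≤2 (normalize t) g ⟩
  2                         ∎
  where open ≤-Reasoning

groupable-length : ∀ {m s} → Normalized s → GroupableIn m s → length s ≤ m * 4 + 2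
groupable-length {m} {s} ns (t , s→t , g) = begin
  length s         ≡⟨ runs-normalized ns ⟨
  runs s           ≤⟨ reach-runs s→t ⟩
  m * 4 + runs t   ≤⟨ +-monoʳ-≤ (m * 4) (grouped-runs t g) ⟩
  m * 4 + 2        ∎
  where open ≤-Reasoning

ceil-quarter-≤ : ∀ n m → n ≤ m * 4 + 2 → (n ∸ 2 + 3) / 4 ≤ m
ceil-quarter-≤ n m n≤ = m<1+n⇒m≤n (m<n*o⇒m/o<n {n = suc m} bound)
  where
  open ≤-Reasoning
  bound : n ∸ 2 + 3 < suc m * 4
  bound = begin-strict
    n ∸ 2 + 3         <⟨ n<1+n _ ⟩
    suc (n ∸ 2 + 3)   ≡⟨ +-suc (n ∸ 2) 3 ⟨
    n ∸ 2 + 4         ≤⟨ +-monoˡ-≤ 4 (∸-monoˡ-≤ 2 n≤) ⟩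
    m * 4 + 2 ∸ 2 + 4 ≡⟨ cong (_+ 4) (m+n∸n≡m (m * 4) 2) ⟩
    m * 4 + 4         ≡⟨ +-comm (m * 4) 4 ⟩
    suc m * 4         ∎

alt : Bool → ℕ → BinStr
alt a zero = []
alt a (suc n) = a ∷ alt (not a) n

alt-normalized : ∀ a n → Normalized (alt a n)
alt-normalized a zero = nil
alt-normalized a (suc zero) = one a
alt-normalized false (suc (suc n)) = cons (λ ()) (alt-normalized true (suc n))
alt-normalized true (suc (suc n)) = cons (λ ()) (alt-normalized false (suc n))

distinct-not : ∀ {a b : Bool} → ¬ a ≡ b → b ≡ not a
distinct-not {false} {false} a≢b = ⊥-elim (a≢b refl)
distinct-not {false} {true} _ = refl
distinct-not {true} {false} _ = refl
distinct-not {true} {true} a≢b = ⊥-elim (a≢b refl)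

normalized-alt : ∀ {a s} → Normalized (a ∷ s) → a ∷ s ≡ alt a (suc (length s))
normalized-alt (one a) = refl
normalized-alt {a} (cons a≢b n) with distinct-not a≢b
... | refl = cong (a ∷_) (normalized-alt n)

normalize-id : ∀ {s} → Normalized s → normalize s ≡ s
normalize-id nil = refl
normalize-id (one a) = refl
normalize-id (cons {a} {b} a≢b n) with a ≟ᵇ b
... | yes a≡b = ⊥-elim (a≢b a≡b)
... | no _ = cong (a ∷_) (normalize-id n)

-- β(2,2,5,5) maps a ā a ā a ā r to a a a ā ā ā r, i.e. to a ā r after
-- normalization: four symbols are removed.
shorten : ∀ a m → RPBIStep (alt a (6 + m)) (alt a (2 + m))
shorten a m = subst (RPBIStep (alt a (6 + m))) (normalizes-to a)
  (step 5 5 (s≤s (s≤s (s≤s z≤n))) ≤-refl (s≤s (s≤s (s≤s (s≤s (s≤s z≤n))))))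
  where
  normalizes-to : ∀ a → normalize (β 2 2 5 5 (alt a (6 + m))) ≡ alt a (2 + m)
  normalizes-to true = cong (true ∷_) (normalize-id (alt-normalized false (suc m)))
  normalizes-to false = cong (false ∷_) (normalize-id (alt-normalized true (suc m)))

alt2-grouped : ∀ a → Grouped (alt a 2)
alt2-grouped true = ((λ ()) ∷ []) ∷ [] ∷ []
alt2-grouped false = ((λ ()) ∷ []) ∷ [] ∷ []

groupable-step : ∀ {k s t} → RPBIStep s t → GroupableIn k t → GroupableIn (suc k) s
groupable-step s→t (u , t→u , g) = u , more s→t t→u , g

groupable-to-pair : ∀ {s} a → RPBIStep s (alt a 2) → GroupableIn 1 s
groupable-to-pair a s→pair = groupable-step s→pair (alt a 2 , done , alt2-grouped a)

-- An alternating string of length n + 2 is grouped in ⌈n/4⌉ steps: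
-- lengths 3 and 4 by β(2,2,3,3), length 5 by β(2,2,5,5), and longer
-- strings are first shortened by four.
alt-groupable : ∀ n a → GroupableIn ((n + 3) / 4) (alt a (2 + n))
alt-groupable 0 a = alt a 2 , done , alt2-grouped a
alt-groupable 1 true = groupable-to-pair true (step 3 3 ≤-refl ≤-refl ≤-refl)
alt-groupable 1 false = groupable-to-pair false (step 3 3 ≤-refl ≤-refl ≤-refl)
alt-groupable 2 true = groupable-to-pair true (step 3 3 ≤-refl ≤-refl (n≤1+n 3))
alt-groupable 2 false = groupable-to-pair false (step 3 3 ≤-refl ≤-refl (n≤1+n 3))
alt-groupable 3 true = groupable-to-pair true (step 5 5 (m≤m+n 3 2) ≤-refl ≤-refl)
alt-groupable 3 false = groupable-to-pair false (step 5 5 (m≤m+n 3 2) ≤-refl ≤-refl)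
alt-groupable (suc (suc (suc (suc m)))) a =
  subst (λ d → GroupableIn d (alt a (6 + m))) (sym quotient)
    (groupable-step (shorten a m) (alt-groupable m a))
  where
  quotient : (4 + m + 3) / 4 ≡ suc ((m + 3) / 4)
  quotient = m/n≡1+[m∸n]/n (m≤m+n 4 (m + 3))

theorem1 : ∀ s → FullyNormalized s → 2 ≤ length s →
             IsDistRPBIg s ((length s ∸ 2 + 3) / 4)
theorem1 (a ∷ []) _ (s≤s ())
theorem1 s@(a ∷ b ∷ r) (ns , _ , _) _ = upper , lower
  where
  upper : GroupableIn ((length r + 3) / 4) s
  upper = subst (GroupableIn _) (sym (normalized-alt ns)) (alt-groupable (length r) a)

  lower : ∀ m → m < (length r + 3) / 4 → ¬ GroupableIn m s
  lower m m<d g = <⇒≱ m<d (ceil-quarter-≤ (length s) m (groupable-length ns g))
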